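{- Let $r$ be a positive integer and let $G$ be a $K_{1,r}$-free graph of order $n$ with $s'$ strong support vertices. Then $$\gamma_{cI}(G)\geq \frac{2(n+s')}{1+r},$$ and this bound is sharp.
   Context: All graphs are finite and simple. $G$ is $K_{1,r}$-free if it contains no induced subgraph isomorphic to the star $K_{1,r}$. A support vertex is a vertex adjacent to a leaf (vertex of degree one); it is strong if it is adjacent to more than one leaf. A function $f:V(G)\to\{0,1,2\}$ is a covering Italian dominating function (CID function) of $G$ if (i) for every vertex $v$ with $f(v)=0$ we have $\sum_{u\in N(v)} f(u)\geq 2$, where $N(v)$ is the open neighborhood of $v$, and (ii) the set $\{v: f(v)=0\}$ is independent. $\gamma_{cI}(G)$ is the minimum of $\sum_v f(v)$ over all CID functions $f$ of $G$. -}

module Defs where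

open import Data.Nat using (ℕ; zero; suc; _+_; _*_; _≤_; _≡ᵇ_; _≤ᵇ_)
open import Data.Bool using (Bool; true; false; if_then_else_)
open import Data.Fin using (Fin)
open import Data.List using (List; map; allFin)
open import Data.Nat.ListAction using (sum)
open import Data.Product using (Σ; _×_; ∃)
open import Relation.Binary.PropositionalEquality using (_≡_; _≢_)
open import Relation.Nullary using (¬_)

record Graph (n : ℕ) : Set where
  field
    adj     : Fin n → Fin n → Bool
    symm    : ∀ u v → adj u v ≡ adj v u
    irrefl  : ∀ v → adj v v ≡ false
open Graph public

sumV : {n : ℕ} → (Fin n → ℕ) → ℕ
sumV {n} g = sum (map g (allFin n))

countV : {n : ℕ} → (Fin n → Bool) → ℕ
countV p = sumV (λ v → if p v then 1 else 0)

degree : {n : ℕ} → Graph n → Fin n → ℕ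
degree G v = countV (adj G v)

isLeaf : {n : ℕ} → Graph n → Fin n → Bool
isLeaf G v = degree G v ≡ᵇ 1

leafNeighbours : {n : ℕ} → Graph n → Fin n → ℕ
leafNeighbours G v = countV (λ u → if adj G v u then isLeaf G u else false)

isStrongSupport : {n : ℕ} → Graph n → Fin n → Bool
isStrongSupport G v = 2 ≤ᵇ leafNeighbours G v

strongSupportCount : {n : ℕ} → Graph n → ℕ
strongSupportCount G = countV (isStrongSupport G)

HasInducedStar : {n : ℕ} → Graph n → ℕ → Set
HasInducedStar {n} G r =
  Σ (Fin n) λ c → Σ (Fin r → Fin n) λ ℓ →
    (∀ i j → ℓ i ≡ ℓ j → i ≡ j)
    × (∀ i → adj G c (ℓ i) ≡ true)
    × (∀ i j → i ≢ j → adj G (ℓ i) (ℓ j) ≡ false)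

K1r-free : {n : ℕ} → Graph n → ℕ → Set
K1r-free G r = ¬ HasInducedStar G r

nbrSum : {n : ℕ} → Graph n → (Fin n → ℕ) → Fin n → ℕ
nbrSum G f v = sumV (λ u → if adj G v u then f u else 0)

weight : {n : ℕ} → (Fin n → ℕ) → ℕ
weight f = sumV f

IsCID : {n : ℕ} → Graph n → (Fin n → ℕ) → Set
IsCID G f =
    (∀ v → f v ≤ 2)
  × (∀ v → f v ≡ 0 → 2 ≤ nbrSum G f v)
  × (∀ u v → f u ≡ 0 → f v ≡ 0 → adj G u v ≡ false)

IsγcI : {n : ℕ} → Graph n → ℕ → Set
IsγcI G k = (Σ _ λ f → IsCID G f × weight f ≡ k)
          × (∀ f → IsCID G f → k ≤ weight f)

-- Discharging. Every vertex u starts with charge (1 + r)·f(u). It keeps 2·f(u), sends f(u) to each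
-- neighbour of value 0, and, if u is a leaf, sends 1 to its neighbour when that neighbour is a "needy"
-- strong support vertex (one with f ≤ 1). No vertex overspends: the zeros are independent, so in a
-- K_{1,r}-free graph u has fewer than r neighbours of value 0; and a paying leaf has value at least 1
-- (its only neighbour cannot dominate it) while r ≥ 3, since its neighbour centres an induced K_{1,2}.
-- Every vertex v ends with at least 2 + 2·[v is a strong support vertex]: a zero receives 2 by
-- domination, and a needy vertex receives 1 from each of its at least two leaves. Summing,
-- 2(n + s') ≤ (1 + r)·w(f). Equality holds for K_1, K_3 and the star K_{1,r-1} (r = 1, 2, ≥ 3).

module Submission where

open import Defs
open import Data.Bool using (Bool; true; false; if_then_else_; _∧_; not)
open import Data.Bool.Properties using (T-≡; ∧-conicalˡ; ∧-conicalʳ; if-float; not-¬)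
open import Data.Empty using (⊥-elim)
open import Data.Fin using (Fin; zero; suc; inject≤; _≟_; punchOut)
open import Data.Fin.Properties
  using (suc-injective; inject≤-injective; pigeonhole; <⇒≢; 0≢1+n; punchOut-injective)
open import Data.List using (tabulate)
open import Data.List.Properties using (map-tabulate)
import Data.Nat.ListAction as ListAction
open import Data.Nat using (ℕ; zero; suc; _+_; _*_; _≤_; _<_; _≡ᵇ_; _≤ᵇ_; z≤n; s≤s; ≢-nonZero)
open import Data.Nat.Properties
  using ( +-*-semiring; module ≤-Reasoning; ≤-refl; ≤-reflexive; ≤-trans; ≤-pred; ≰⇒>; 1+n≰n; n<1+n
        ; ≡ᵇ⇒≡; ≤ᵇ⇒≤; m≤m+n; m≤n⇒m≤o+n; +-comm; +-identityʳ; +-mono-≤; +-monoʳ-≤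
        ; *-comm; *-identityʳ; *-zeroʳ; *-distribˡ-+; *-distribʳ-+; *-monoˡ-≤; *-monoʳ-≤; *-monoˡ-<
        ; *-cancelˡ-≤ )
open import Algebra.Properties.Semiring.Sum +-*-semiring
  using (sum; sum-cong-≗; sum-replicate-zero; ∑-comm; *-distribˡ-sum; *-distribʳ-sum; ∑-distrib-+)
open import Data.Product using (Σ; _×_; _,_; proj₁; proj₂)
open import Function using (id; _∘_; Equivalence)
open import Relation.Binary.PropositionalEquality
  using (_≡_; _≢_; refl; sym; trans; cong; cong₂; subst; subst₂; module ≡-Reasoning)
open import Relation.Nullary using (yes; no)
open import Relation.Nullary.Decidable using (⌊_⌋)

indicator : Bool → ℕ
indicator b = if b then 1 else 0

count : ∀ {n} → (Fin n → Bool) → ℕ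
count p = sum (λ v → indicator (p v))

sumV≡sum : ∀ {n} (g : Fin n → ℕ) → sumV g ≡ sum g
sumV≡sum g = trans (cong ListAction.sum (map-tabulate id g)) (sum-tabulate g)
  where
  sum-tabulate : ∀ {m} (h : Fin m → ℕ) → ListAction.sum (tabulate h) ≡ sum h
  sum-tabulate {zero}  h = refl
  sum-tabulate {suc m} h = cong (h zero +_) (sum-tabulate (h ∘ suc))

countV≡count : ∀ {n} (p : Fin n → Bool) → countV p ≡ count p
countV≡count p = sumV≡sum (indicator ∘ p)

count-true : ∀ n → count {n} (λ _ → true) ≡ n
count-true zero    = refl
count-true (suc n) = cong suc (count-true n)

sum-mono-≤ : ∀ {n} {g h : Fin n → ℕ} → (∀ v → g v ≤ h v) → sum g ≤ sum h
sum-mono-≤ {zero}  g≤h = z≤n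
sum-mono-≤ {suc n} g≤h = +-mono-≤ (g≤h zero) (sum-mono-≤ (g≤h ∘ suc))

sum-≥-term : ∀ {n} (g : Fin n → ℕ) x → g x ≤ sum g
sum-≥-term g zero    = m≤m+n (g zero) _
sum-≥-term g (suc x) = m≤n⇒m≤o+n (g zero) (sum-≥-term (g ∘ suc) x)

sum-≥-pair : ∀ {n} (g : Fin n → ℕ) {x y} → x ≢ y → g x + g y ≤ sum g
sum-≥-pair g {zero}  {zero}  x≢y = ⊥-elim (x≢y refl)
sum-≥-pair g {zero}  {suc y} x≢y = +-monoʳ-≤ (g zero) (sum-≥-term (g ∘ suc) y)
sum-≥-pair g {suc x} {zero}  x≢y = subst (_≤ sum g) (+-comm (g zero) _) (sum-≥-pair g (x≢y ∘ sym))
sum-≥-pair g {suc x} {suc y} x≢y = m≤n⇒m≤o+n (g zero) (sum-≥-pair (g ∘ suc) (x≢y ∘ cong suc))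

count-∧-≤ : ∀ {n} (p q : Fin n → Bool) → count (λ v → p v ∧ q v) ≤ count p
count-∧-≤ p q = sum-mono-≤ λ v → indicator-∧ (p v) (q v)
  where
  indicator-∧ : ∀ a b → indicator (a ∧ b) ≤ indicator a
  indicator-∧ true  true  = ≤-refl
  indicator-∧ true  false = z≤n
  indicator-∧ false _     = z≤n

≤count⇒injection : ∀ {n} (p : Fin n → Bool) {r} → r ≤ count p →
  Σ (Fin r → Fin n) λ ℓ → (∀ i j → ℓ i ≡ ℓ j → i ≡ j) × (∀ i → p (ℓ i) ≡ true)
≤count⇒injection p {zero} _ = (λ ()) , (λ ()) , (λ ())
≤count⇒injection {suc n} p {suc r} r≤ with p zero in p0
... | false =
  let ℓ , inj , pℓ = ≤count⇒injection (p ∘ suc) r≤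
  in suc ∘ ℓ , (λ i j → inj i j ∘ suc-injective) , pℓ
... | true =
  let ℓ , inj , pℓ = ≤count⇒injection (p ∘ suc) (≤-pred r≤)
      ℓ′ : Fin (suc r) → Fin (suc n)
      ℓ′ = λ { zero → zero ; (suc i) → suc (ℓ i) }
      inj′ : ∀ i j → ℓ′ i ≡ ℓ′ j → i ≡ j
      inj′ = λ { zero zero _ → refl ; (suc i) (suc j) e → cong suc (inj i j (suc-injective e)) }
      pℓ′ : ∀ i → p (ℓ′ i) ≡ true
      pℓ′ = λ { zero → p0 ; (suc i) → pℓ i }
  in ℓ′ , inj′ , pℓ′

∑-count-*-comm : ∀ {n} (M : Fin n → Fin n → Bool) (p : Fin n → Bool) (a : Fin n → ℕ) →
  sum (λ u → count (λ v → M u v ∧ p v) * a u)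
    ≡ sum (λ v → indicator (p v) * sum (λ u → if M u v then a u else 0))
∑-count-*-comm M p a = begin
  sum (λ u → count (λ v → M u v ∧ p v) * a u)
    ≡⟨ sum-cong-≗ (λ u → *-distribʳ-sum (a u) (λ v → indicator (M u v ∧ p v))) ⟩
  sum (λ u → sum (λ v → indicator (M u v ∧ p v) * a u))
    ≡⟨ ∑-comm (λ u v → indicator (M u v ∧ p v) * a u) ⟩
  sum (λ v → sum (λ u → indicator (M u v ∧ p v) * a u))
    ≡⟨ sum-cong-≗ (λ v → sum-cong-≗ (λ u → pointwise (M u v) (p v) (a u))) ⟩
  sum (λ v → sum (λ u → indicator (p v) * (if M u v then a u else 0)))
    ≡⟨ sum-cong-≗ (λ v → *-distribˡ-sum (indicator (p v)) (λ u → if M u v then a u else 0)) ⟨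
  sum (λ v → indicator (p v) * sum (λ u → if M u v then a u else 0)) ∎
  where
  open ≡-Reasoning
  pointwise : ∀ m q x → indicator (m ∧ q) * x ≡ indicator q * (if m then x else 0)
  pointwise true  true  x = refl
  pointwise true  false x = refl
  pointwise false q     x = sym (*-zeroʳ (indicator q))

*-count-≤-∑ : ∀ {n} (p : Fin n → Bool) (g : Fin n → ℕ) k →
  (∀ v → p v ≡ true → k ≤ g v) → k * count p ≤ sum (λ v → indicator (p v) * g v)
*-count-≤-∑ p g k k≤g = begin
  k * count p                              ≡⟨ *-distribˡ-sum k (indicator ∘ p) ⟩
  sum (λ v → k * indicator (p v))          ≤⟨ sum-mono-≤ pointwise ⟩
  sum (λ v → indicator (p v) * g v)        ∎
  where
  open ≤-Reasoning
  pointwise : ∀ v → k * indicator (p v) ≤ indicator (p v) * g v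
  pointwise v with p v in pv
  ... | true  = subst₂ _≤_ (sym (*-identityʳ k)) (sym (+-identityʳ (g v))) (k≤g v pv)
  ... | false = ≤-reflexive (*-zeroʳ k)

module _ {n} (G : Graph n) where

  K1r-free-mono : ∀ {r s} → r ≤ s → K1r-free G r → K1r-free G s
  K1r-free-mono {r} {s} r≤s free (c , ℓ , inj , adjacent , nonadjacent) =
    free (c , ℓ ∘ ι , (λ i j → ι-injective i j ∘ inj (ι i) (ι j)) , adjacent ∘ ι ,
          λ i j i≢j → nonadjacent (ι i) (ι j) (i≢j ∘ ι-injective i j))
    where
    ι : Fin r → Fin s
    ι i = inject≤ i r≤s
    ι-injective : ∀ i j → ι i ≡ ι j → i ≡ j
    ι-injective = inject≤-injective r≤s r≤s

  star₂⇒3≤r : ∀ {r} → K1r-free G r → HasInducedStar G 2 → 3 ≤ r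
  star₂⇒3≤r free star = ≰⇒> λ r≤2 → K1r-free-mono r≤2 free star

  leaf⇒degree≡1 : ∀ {u} → isLeaf G u ≡ true → degree G u ≡ 1
  leaf⇒degree≡1 {u} leaf = ≡ᵇ⇒≡ (degree G u) 1 (Equivalence.from T-≡ leaf)

  leaf-neighbour-unique : ∀ {u x y} → isLeaf G u ≡ true →
    adj G u x ≡ true → adj G u y ≡ true → x ≡ y
  leaf-neighbour-unique {u} {x} {y} leaf ux uy with x ≟ y
  ... | yes x≡y = x≡y
  ... | no x≢y  = ⊥-elim (1+n≰n (subst (2 ≤_) (leaf⇒degree≡1 leaf) two-neighbours))
    where
    open ≤-Reasoning
    two-neighbours : 2 ≤ degree G u
    two-neighbours = begin
      2                                           ≡⟨ cong₂ (λ a b → indicator a + indicator b) ux uy ⟨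
      indicator (adj G u x) + indicator (adj G u y) ≤⟨ sum-≥-pair (indicator ∘ adj G u) x≢y ⟩
      count (adj G u)                             ≡⟨ countV≡count (adj G u) ⟨
      degree G u                                  ∎

  nbrSum-≤ : ∀ (g : Fin n → ℕ) k u → (∀ w → adj G u w ≡ true → g w ≤ k) →
    nbrSum G g u ≤ k * degree G u
  nbrSum-≤ g k u g≤k = begin
    nbrSum G g u                              ≡⟨ sumV≡sum (λ w → if adj G u w then g w else 0) ⟩
    sum (λ w → if adj G u w then g w else 0)  ≤⟨ sum-mono-≤ pointwise ⟩
    sum (λ w → k * indicator (adj G u w))     ≡⟨ *-distribˡ-sum k (indicator ∘ adj G u) ⟨
    k * count (adj G u)                       ≡⟨ cong (k *_) (countV≡count (adj G u)) ⟨
    k * degree G u                            ∎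
    where
    open ≤-Reasoning
    pointwise : ∀ w → (if adj G u w then g w else 0) ≤ k * indicator (adj G u w)
    pointwise w with adj G u w in uw
    ... | true  = subst (g w ≤_) (sym (*-identityʳ k)) (g≤k w uw)
    ... | false = z≤n

  ∑-adj-sym : ∀ (g : Fin n → ℕ) v → sum (λ u → if adj G u v then g u else 0) ≡ nbrSum G g v
  ∑-adj-sym g v = trans (sum-cong-≗ λ u → cong (λ b → if b then g u else 0) (symm G u v))
                        (sym (sumV≡sum (λ u → if adj G v u then g u else 0)))

  isLeafNeighbour : Fin n → Fin n → Bool
  isLeafNeighbour v u = if adj G v u then isLeaf G u else false

  leafNeighbours≡nbrSum : ∀ v → leafNeighbours G v ≡ nbrSum G (indicator ∘ isLeaf G) v
  leafNeighbours≡nbrSum v = begin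
    leafNeighbours G v                               ≡⟨ countV≡count (isLeafNeighbour v) ⟩
    count (isLeafNeighbour v)                        ≡⟨ sum-cong-≗ (λ u → if-float indicator (adj G v u)) ⟩
    sum leafTerm                                     ≡⟨ sumV≡sum leafTerm ⟨
    nbrSum G (indicator ∘ isLeaf G) v                ∎
    where
    open ≡-Reasoning
    leafTerm : Fin n → ℕ
    leafTerm u = if adj G v u then indicator (isLeaf G u) else 0

  leaf-sibling-nonadjacent : ∀ {v x y} → adj G v x ≡ true → isLeaf G x ≡ true →
    adj G v y ≡ true → adj G x y ≡ false
  leaf-sibling-nonadjacent {v} {x} {y} vx leaf vy with adj G x y in xy
  ... | false = refl
  ... | true  = ⊥-elim (not-¬ (irrefl G v) (subst (λ w → adj G v w ≡ true) y≡v vy))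
    where
    y≡v : y ≡ v
    y≡v = leaf-neighbour-unique leaf xy (trans (symm G x v) vx)

  strongSupport⇒star₂ : ∀ {v} → isStrongSupport G v ≡ true → HasInducedStar G 2
  strongSupport⇒star₂ {v} strong =
    let ℓ , inj , leafNeighbour = ≤count⇒injection (isLeafNeighbour v) ≤leafNeighbours
        adjacent = λ i → proj₁ (split (leafNeighbour i))
    in v , ℓ , inj , adjacent ,
       λ i j _ → leaf-sibling-nonadjacent (adjacent i) (proj₂ (split (leafNeighbour i))) (adjacent j)
    where
    ≤leafNeighbours : 2 ≤ count (isLeafNeighbour v)
    ≤leafNeighbours = subst (2 ≤_) (countV≡count (isLeafNeighbour v))
                            (≤ᵇ⇒≤ 2 (leafNeighbours G v) (Equivalence.from T-≡ strong))
    split : ∀ {a b} → (if a then b else false) ≡ true → (a ≡ true) × (b ≡ true)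
    split {true} {true} refl = refl , refl

charge-bound : ∀ {a c h r} → c < r → (1 ≤ h → a ≢ 0 × 2 + c < 1 + r × h ≤ 1) →
  2 * a + c * a + h ≤ (1 + r) * a
charge-bound {a} {c} {0} {r} c<r _ = begin
  2 * a + c * a + 0  ≡⟨ +-identityʳ _ ⟩
  2 * a + c * a      ≡⟨ *-distribʳ-+ a 2 c ⟨
  (2 + c) * a        ≤⟨ *-monoˡ-≤ a (s≤s c<r) ⟩
  (1 + r) * a        ∎
  where open ≤-Reasoning
charge-bound {a} {c} {1} {r} _ leafCase with leafCase ≤-refl
... | a≢0 , slack , _ = begin
  2 * a + c * a + 1    ≡⟨ +-comm _ 1 ⟩
  1 + (2 * a + c * a)  ≡⟨ cong suc (*-distribʳ-+ a 2 c) ⟨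
  1 + (2 + c) * a      ≤⟨ *-monoˡ-< a {{≢-nonZero a≢0}} slack ⟩
  (1 + r) * a          ∎
  where open ≤-Reasoning
charge-bound {h = suc (suc _)} _ leafCase with leafCase (s≤s z≤n)
... | _ , _ , s≤s ()

demand-bound : ∀ b x → x ≤ 2 → 1 + indicator b ≤ x + indicator (x ≡ᵇ 0) + indicator (b ∧ (x ≤ᵇ 1))
demand-bound false 0 _ = ≤-refl
demand-bound true  0 _ = ≤-refl
demand-bound false 1 _ = ≤-refl
demand-bound true  1 _ = ≤-refl
demand-bound false 2 _ = s≤s z≤n
demand-bound true  2 _ = ≤-refl
demand-bound _ (suc (suc (suc _))) (s≤s (s≤s ()))

module Discharging {n} (G : Graph n) {r} (free : K1r-free G r) {f : Fin n → ℕ} (cid : IsCID G f) where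

  f≤2 : ∀ v → f v ≤ 2
  f≤2 = proj₁ cid

  dominated : ∀ v → f v ≡ 0 → 2 ≤ nbrSum G f v
  dominated = proj₁ (proj₂ cid)

  independent : ∀ u v → f u ≡ 0 → f v ≡ 0 → adj G u v ≡ false
  independent = proj₂ (proj₂ cid)

  isZero : Fin n → Bool
  isZero v = f v ≡ᵇ 0

  needy : Fin n → Bool
  needy v = isStrongSupport G v ∧ (f v ≤ᵇ 1)

  isZero⇒≡0 : ∀ {v} → isZero v ≡ true → f v ≡ 0
  isZero⇒≡0 {v} z = ≡ᵇ⇒≡ (f v) 0 (Equivalence.from T-≡ z)

  needy⇒strong : ∀ {v} → needy v ≡ true → isStrongSupport G v ≡ true
  needy⇒strong {v} = ∧-conicalˡ (isStrongSupport G v) (f v ≤ᵇ 1)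

  needy⇒≤1 : ∀ {v} → needy v ≡ true → f v ≤ 1
  needy⇒≤1 {v} nv = ≤ᵇ⇒≤ (f v) 1 (Equivalence.from T-≡ (∧-conicalʳ (isStrongSupport G v) (f v ≤ᵇ 1) nv))

  zeroNeighbours : Fin n → ℕ
  zeroNeighbours u = count (λ v → adj G u v ∧ isZero v)

  needyNeighbours : Fin n → ℕ
  needyNeighbours u = count (λ v → adj G u v ∧ needy v)

  leafPayment : Fin n → ℕ
  leafPayment u = needyNeighbours u * indicator (isLeaf G u)

  charge : Fin n → ℕ
  charge u = 2 * f u + zeroNeighbours u * f u + leafPayment u

  zeroNeighbours<r : ∀ u → zeroNeighbours u < r
  zeroNeighbours<r u = ≰⇒> λ r≤ →
    let ℓ , inj , pℓ = ≤count⇒injection (λ v → adj G u v ∧ isZero v) r≤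
        isZeroℓ = λ i → isZero⇒≡0 (∧-conicalʳ _ _ (pℓ i))
    in free (u , ℓ , inj , (λ i → ∧-conicalˡ _ _ (pℓ i)) ,
             λ i j _ → independent (ℓ i) (ℓ j) (isZeroℓ i) (isZeroℓ j))

  leaf-with-needy-neighbour : ∀ {u v} → isLeaf G u ≡ true → adj G u v ≡ true → needy v ≡ true →
    f u ≢ 0 × 2 + zeroNeighbours u < 1 + r × needyNeighbours u ≤ 1
  leaf-with-needy-neighbour {u} {v} leaf uv needy-v = fu≢0 , slack , needyNeighbours≤1
    where
    degree≡1 : count (adj G u) ≡ 1
    degree≡1 = trans (sym (countV≡count (adj G u))) (leaf⇒degree≡1 G leaf)
    nbrSum≤1 : nbrSum G f u ≤ 1
    nbrSum≤1 = subst (nbrSum G f u ≤_) (cong (1 *_) (leaf⇒degree≡1 G leaf))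
      (nbrSum-≤ G f 1 u λ w uw →
        subst (λ x → f x ≤ 1) (leaf-neighbour-unique G leaf uv uw) (needy⇒≤1 needy-v))
    fu≢0 : f u ≢ 0
    fu≢0 fu≡0 = 1+n≰n (≤-trans (dominated u fu≡0) nbrSum≤1)
    zeroNeighbours≤1 : zeroNeighbours u ≤ 1
    zeroNeighbours≤1 = subst (zeroNeighbours u ≤_) degree≡1 (count-∧-≤ (adj G u) isZero)
    slack : 2 + zeroNeighbours u < 1 + r
    slack = ≤-trans (s≤s (s≤s (s≤s zeroNeighbours≤1)))
                    (s≤s (star₂⇒3≤r G free (strongSupport⇒star₂ G (needy⇒strong needy-v))))
    needyNeighbours≤1 : needyNeighbours u ≤ 1
    needyNeighbours≤1 = subst (needyNeighbours u ≤_) degree≡1 (count-∧-≤ (adj G u) needy)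

  leafPayment-bound : ∀ u → 1 ≤ leafPayment u →
    f u ≢ 0 × 2 + zeroNeighbours u < 1 + r × leafPayment u ≤ 1
  leafPayment-bound u pos with isLeaf G u in leaf
  ... | false = ⊥-elim (1+n≰n (subst (1 ≤_) (*-zeroʳ (needyNeighbours u)) pos))
  ... | true rewrite *-identityʳ (needyNeighbours u) =
    let ℓ , _ , pℓ = ≤count⇒injection (λ w → adj G u w ∧ needy w) pos
        v = ℓ zero
    in leaf-with-needy-neighbour leaf (∧-conicalˡ (adj G u v) (needy v) (pℓ zero))
                                    (∧-conicalʳ (adj G u v) (needy v) (pℓ zero))

  charge≤ : ∀ u → charge u ≤ (1 + r) * f u
  charge≤ u = charge-bound (zeroNeighbours<r u) (leafPayment-bound u)

  zeros-received : 2 * count isZero ≤ sum (λ u → zeroNeighbours u * f u)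
  zeros-received = begin
    2 * count isZero
      ≤⟨ *-count-≤-∑ isZero (nbrSum G f) 2 (λ v → dominated v ∘ isZero⇒≡0) ⟩
    sum (λ v → indicator (isZero v) * nbrSum G f v)
      ≡⟨ sum-cong-≗ (λ v → cong (indicator (isZero v) *_) (∑-adj-sym G f v)) ⟨
    sum (λ v → indicator (isZero v) * sum (λ u → if adj G u v then f u else 0))
      ≡⟨ ∑-count-*-comm (adj G) isZero f ⟨
    sum (λ u → zeroNeighbours u * f u) ∎
    where open ≤-Reasoning

  needy-received : 2 * count needy ≤ sum leafPayment
  needy-received = begin
    2 * count needy
      ≤⟨ *-count-≤-∑ needy (nbrSum G leafIndicator) 2 ≤leafNeighbours ⟩
    sum (λ v → indicator (needy v) * nbrSum G leafIndicator v)
      ≡⟨ sum-cong-≗ (λ v → cong (indicator (needy v) *_) (∑-adj-sym G leafIndicator v)) ⟨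
    sum (λ v → indicator (needy v) * sum (λ u → if adj G u v then leafIndicator u else 0))
      ≡⟨ ∑-count-*-comm (adj G) needy leafIndicator ⟨
    sum leafPayment ∎
    where
    open ≤-Reasoning
    leafIndicator : Fin n → ℕ
    leafIndicator = indicator ∘ isLeaf G
    ≤leafNeighbours : ∀ v → needy v ≡ true → 2 ≤ nbrSum G leafIndicator v
    ≤leafNeighbours v needy-v = subst (2 ≤_) (leafNeighbours≡nbrSum G v)
      (≤ᵇ⇒≤ 2 (leafNeighbours G v) (Equivalence.from T-≡ (needy⇒strong needy-v)))

  demand≤ : n + strongSupportCount G ≤ weight f + count isZero + count needy
  demand≤ = begin
    n + strongSupportCount G
      ≡⟨ cong₂ _+_ (count-true n) (sym (countV≡count (isStrongSupport G))) ⟨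
    count {n} (λ _ → true) + count (isStrongSupport G)
      ≡⟨ ∑-distrib-+ (λ _ → 1) (indicator ∘ isStrongSupport G) ⟨
    sum (λ v → 1 + indicator (isStrongSupport G v))
      ≤⟨ sum-mono-≤ (λ v → demand-bound (isStrongSupport G v) (f v) (f≤2 v)) ⟩
    sum (λ v → f v + indicator (isZero v) + indicator (needy v))
      ≡⟨ ∑-distrib-+ (λ v → f v + indicator (isZero v)) (indicator ∘ needy) ⟩
    sum (λ v → f v + indicator (isZero v)) + count needy
      ≡⟨ cong (_+ count needy) (∑-distrib-+ f (indicator ∘ isZero)) ⟩
    sum f + count isZero + count needy
      ≡⟨ cong (λ w → w + count isZero + count needy) (sumV≡sum f) ⟨
    weight f + count isZero + count needy ∎
    where open ≤-Reasoning

  charge-total : 2 * (n + strongSupportCount G) ≤ sum charge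
  charge-total = begin
    2 * (n + strongSupportCount G)
      ≤⟨ *-monoʳ-≤ 2 demand≤ ⟩
    2 * (weight f + count isZero + count needy)
      ≡⟨ trans (*-distribˡ-+ 2 (weight f + count isZero) (count needy))
               (cong (_+ 2 * count needy) (*-distribˡ-+ 2 (weight f) (count isZero))) ⟩
    2 * weight f + 2 * count isZero + 2 * count needy
      ≤⟨ +-mono-≤ (+-monoʳ-≤ (2 * weight f) zeros-received) needy-received ⟩
    2 * weight f + sentToZeros + sum leafPayment
      ≡⟨ cong (λ w → 2 * w + sentToZeros + sum leafPayment) (sumV≡sum f) ⟩
    2 * sum f + sentToZeros + sum leafPayment
      ≡⟨ cong (λ w → w + sentToZeros + sum leafPayment) (*-distribˡ-sum 2 f) ⟩
    sum (λ u → 2 * f u) + sentToZeros + sum leafPayment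
      ≡⟨ cong (_+ sum leafPayment) (∑-distrib-+ (λ u → 2 * f u) (λ u → zeroNeighbours u * f u)) ⟨
    sum (λ u → 2 * f u + zeroNeighbours u * f u) + sum leafPayment
      ≡⟨ ∑-distrib-+ (λ u → 2 * f u + zeroNeighbours u * f u) leafPayment ⟨
    sum charge ∎
    where
    open ≤-Reasoning
    sentToZeros : ℕ
    sentToZeros = sum (λ u → zeroNeighbours u * f u)

  charge-total≤ : sum charge ≤ (1 + r) * weight f
  charge-total≤ = begin
    sum charge                 ≤⟨ sum-mono-≤ charge≤ ⟩
    sum (λ u → (1 + r) * f u)  ≡⟨ *-distribˡ-sum (1 + r) f ⟨
    (1 + r) * sum f            ≡⟨ cong ((1 + r) *_) (sumV≡sum f) ⟨
    (1 + r) * weight f         ∎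
    where open ≤-Reasoning

cid-weight-bound : ∀ {n} (G : Graph n) {r} → K1r-free G r → ∀ {f} → IsCID G f →
  2 * (n + strongSupportCount G) ≤ (1 + r) * weight f
cid-weight-bound G free cid = ≤-trans charge-total charge-total≤
  where open Discharging G free cid

γcI-lower-bound : ∀ {n} (G : Graph n) {r} → K1r-free G r → ∀ {k} → IsγcI G k →
  2 * (n + strongSupportCount G) ≤ (1 + r) * k
γcI-lower-bound {n} G {r} free ((f , cid , weight≡k) , _) =
  subst (2 * (n + strongSupportCount G) ≤_) (cong ((1 + r) *_) weight≡k) (cid-weight-bound G free cid)

K1n-free : ∀ {n} (G : Graph n) → K1r-free G n
K1n-free {suc k} G (c , ℓ , inj , adjacent , _) =
  let i , j , i<j , same = pigeonhole (n<1+n k) (λ i → punchOut (c≢ℓ i))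
  in <⇒≢ i<j (inj i j (punchOut-injective (c≢ℓ i) (c≢ℓ j) same))
  where
  c≢ℓ : ∀ i → c ≢ ℓ i
  c≢ℓ i c≡ℓi = not-¬ (irrefl G c) (subst (λ v → adj G c v ≡ true) (sym c≡ℓi) (adjacent i))

BoundAttained : ℕ → Set
BoundAttained r = Σ ℕ λ n → Σ (Graph n) λ G → Σ ℕ λ k →
  1 ≤ n × K1r-free G r × IsγcI G k × 2 * (n + strongSupportCount G) ≡ (1 + r) * k

tight-cid⇒BoundAttained : ∀ {n r} (G : Graph (suc n)) → K1r-free G r → ∀ {f} → IsCID G f →
  2 * (suc n + strongSupportCount G) ≡ (1 + r) * weight f → BoundAttained r
tight-cid⇒BoundAttained {n} {r} G free {f} cid tight =
  suc n , G , weight f , s≤s z≤n , free , ((f , cid , refl) , minimal) , tight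
  where
  minimal : ∀ g → IsCID G g → weight f ≤ weight g
  minimal g cid-g = *-cancelˡ-≤ (1 + r) (subst (_≤ (1 + r) * weight g) tight (cid-weight-bound G free cid-g))

complete : (n : ℕ) → Graph n
complete n = record { adj = λ u v → not ⌊ u ≟ v ⌋ ; symm = symmetric ; irrefl = irreflexive }
  where
  symmetric : ∀ u v → not ⌊ u ≟ v ⌋ ≡ not ⌊ v ≟ u ⌋
  symmetric u v with u ≟ v | v ≟ u
  ... | yes _   | yes _   = refl
  ... | no _    | no _    = refl
  ... | yes u≡v | no v≢u  = ⊥-elim (v≢u (sym u≡v))
  ... | no u≢v  | yes v≡u = ⊥-elim (u≢v (sym v≡u))
  irreflexive : ∀ v → not ⌊ v ≟ v ⌋ ≡ false
  irreflexive v with v ≟ v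
  ... | yes _   = refl
  ... | no v≢v  = ⊥-elim (v≢v refl)

complete-K1,2-free : ∀ n → K1r-free (complete n) 2
complete-K1,2-free n (_ , ℓ , inj , _ , nonadjacent)
  with ℓ zero ≟ ℓ (suc zero) | nonadjacent zero (suc zero) 0≢1+n
... | yes ℓ0≡ℓ1 | _  = 0≢1+n (inj zero (suc zero) ℓ0≡ℓ1)
... | no _      | ()

triangle-attains : BoundAttained 2
triangle-attains =
  tight-cid⇒BoundAttained (complete 3) (complete-K1,2-free 3) {f} (bounded , dominated , independent) refl
  where
  f : Fin 3 → ℕ
  f zero    = 0
  f (suc _) = 1
  bounded : ∀ v → f v ≤ 2
  bounded zero    = z≤n
  bounded (suc _) = s≤s z≤n
  dominated : ∀ v → f v ≡ 0 → 2 ≤ nbrSum (complete 3) f v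
  dominated zero    _  = ≤-refl
  dominated (suc _) ()
  independent : ∀ u v → f u ≡ 0 → f v ≡ 0 → adj (complete 3) u v ≡ false
  independent zero    zero    _  _  = refl
  independent zero    (suc _) _  ()
  independent (suc _) _       ()

starAdj : ∀ {k} → Fin (suc k) → Fin (suc k) → Bool
starAdj zero    zero    = false
starAdj zero    (suc _) = true
starAdj (suc _) zero    = true
starAdj (suc _) (suc _) = false

star : (k : ℕ) → Graph (suc k)
star k = record { adj = starAdj ; symm = symmetric ; irrefl = irreflexive }
  where
  symmetric : ∀ u v → starAdj u v ≡ starAdj v u
  symmetric zero    zero    = refl
  symmetric zero    (suc _) = refl
  symmetric (suc _) zero    = refl
  symmetric (suc _) (suc _) = refl
  irreflexive : ∀ v → starAdj v v ≡ false
  irreflexive zero    = refl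
  irreflexive (suc _) = refl

singleton-attains : BoundAttained 1
singleton-attains = tight-cid⇒BoundAttained (star 0) (K1n-free (star 0)) {λ _ → 1}
  ((λ _ → s≤s z≤n) , (λ _ ()) , (λ _ _ ())) refl

module LargeStar (m : ℕ) where

  k : ℕ
  k = suc (suc m)

  leaf-degree : ∀ i → degree (star k) (suc i) ≡ 1
  leaf-degree i = trans (countV≡count (starAdj (suc i))) (cong suc (sum-replicate-zero k))

  -- With k = 2 + m the first two summands of a sum over Fin k unfold, so the tests 2 ≤ᵇ _ and
  -- _≡ᵇ 1 below evaluate.
  centre-strong : isStrongSupport (star k) zero ≡ true
  centre-strong = cong (2 ≤ᵇ_) leaves
    where
    leaves : leafNeighbours (star k) zero ≡ sum {k} (λ _ → 1)
    leaves = trans (countV≡count (isLeafNeighbour (star k) zero))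
                   (sum-cong-≗ λ i → cong (λ d → indicator (d ≡ᵇ 1)) (leaf-degree i))

  leaf-not-strong : ∀ i → isStrongSupport (star k) (suc i) ≡ false
  leaf-not-strong i = cong (2 ≤ᵇ_) no-leaf-neighbours
    where
    centre-not-leaf : isLeaf (star k) zero ≡ false
    centre-not-leaf = cong (_≡ᵇ 1) (countV≡count (starAdj {k} zero))
    no-leaf-neighbours : leafNeighbours (star k) (suc i) ≡ 0
    no-leaf-neighbours = trans (countV≡count (isLeafNeighbour (star k) (suc i)))
                               (cong₂ _+_ (cong indicator centre-not-leaf) (sum-replicate-zero k))

  strongSupportCount≡1 : strongSupportCount (star k) ≡ 1
  strongSupportCount≡1 = trans (countV≡count (isStrongSupport (star k)))
    (cong₂ _+_ (cong indicator centre-strong)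
               (trans (sum-cong-≗ λ i → cong indicator (leaf-not-strong i)) (sum-replicate-zero k)))

  centre-two : Fin (suc k) → ℕ
  centre-two zero    = 2
  centre-two (suc _) = 0

  centre-two-cid : IsCID (star k) centre-two
  centre-two-cid = bounded , dominated , independent
    where
    bounded : ∀ v → centre-two v ≤ 2
    bounded zero    = ≤-refl
    bounded (suc _) = z≤n
    dominated : ∀ v → centre-two v ≡ 0 → 2 ≤ nbrSum (star k) centre-two v
    dominated (suc i) _ =
      subst (2 ≤_) (sym (sumV≡sum (λ u → if starAdj (suc i) u then centre-two u else 0))) (m≤m+n 2 _)
    independent : ∀ u v → centre-two u ≡ 0 → centre-two v ≡ 0 → starAdj u v ≡ false
    independent (suc _) (suc _) _ _ = refl

  weight≡2 : weight centre-two ≡ 2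
  weight≡2 = trans (sumV≡sum centre-two) (cong (2 +_) (sum-replicate-zero k))

  attains : BoundAttained (suc k)
  attains = tight-cid⇒BoundAttained (star k) (K1n-free (star k)) centre-two-cid (begin
    2 * (suc k + strongSupportCount (star k))  ≡⟨ cong (λ s → 2 * (suc k + s)) strongSupportCount≡1 ⟩
    2 * (suc k + 1)                            ≡⟨ *-comm 2 (suc k + 1) ⟩
    (suc k + 1) * 2                            ≡⟨ cong (_* 2) (+-comm (suc k) 1) ⟩
    (1 + suc k) * 2                            ≡⟨ cong ((1 + suc k) *_) weight≡2 ⟨
    (1 + suc k) * weight centre-two            ∎)
    where open ≡-Reasoning

bound-attained : ∀ r → 1 ≤ r → BoundAttained r
bound-attained 1                   _ = singleton-attains
bound-attained 2                   _ = triangle-attains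
bound-attained (suc (suc (suc m))) _ = LargeStar.attains m

theorem6 : ((r : ℕ) → 1 ≤ r → (n : ℕ) → (G : Graph n) → K1r-free G r →
               (k : ℕ) → IsγcI G k →
               2 * (n + strongSupportCount G) ≤ (1 + r) * k)
           × ((r : ℕ) → 1 ≤ r →
               Σ ℕ λ n → Σ (Graph n) λ G → Σ ℕ λ k →
                 1 ≤ n × K1r-free G r × IsγcI G k ×
                 2 * (n + strongSupportCount G) ≡ (1 + r) * k)
theorem6 = (λ r _ n G free k γ → γcI-lower-bound G free γ) , bound-attained
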